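{- Let $n$ be a positive integer, $\mathbf{p}$ an $n$-dimensional vector with all entries positive, and $\mathbf{M}=(m_{ij})$ a non-negative $n\times n$ matrix that is $q$-approximately-symmetric for some $q\ge 0$, i.e. $m_{ij}\le q\,m_{ji}$ for all $i,j$. If $(\mathbf{M}\mathbf{p})_i\le\mathbf{p}_i$ for all $i$, then $\sum_{i,j}m_{ij}\le (q+1)n$. -}

module Defs where

open import Level using (Level; _⊔_) renaming (suc to lsuc)
import Data.Nat as ℕ
open ℕ using (ℕ)
import Data.Fin as F
open F using (Fin)
open import Data.Product using (∃; _×_)
open import Relation.Nullary using (¬_)
open import Relation.Binary.Core using (Rel)
open import Relation.Binary.Structures using (IsTotalOrder)
open import Algebra.Bundles using (CommutativeRing)

-- An ordered field (the real numbers are one), axiomatised in the standard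
-- way: a commutative ring with 0 ≠ 1 in which every nonzero element has an
-- inverse, together with a total order ≤ (w.r.t. the setoid equality ≈)
-- compatible with + and *.
record OrderedField (c ℓ₁ ℓ₂ : Level) : Set (lsuc (c ⊔ ℓ₁ ⊔ ℓ₂)) where
  field
    commutativeRing : CommutativeRing c ℓ₁
  open CommutativeRing commutativeRing public
  field
    0≉1           : ¬ (0# ≈ 1#)
    inverse       : ∀ x → ¬ (x ≈ 0#) → ∃ λ y → (x * y) ≈ 1#
    _≤_           : Rel Carrier ℓ₂
    isTotalOrder  : IsTotalOrder _≈_ _≤_
    +-mono-≤      : ∀ {x y} z → x ≤ y → (x + z) ≤ (y + z)
    *-nonneg      : ∀ {x y} → 0# ≤ x → 0# ≤ y → 0# ≤ (x * y)

  _<_ : Rel Carrier (ℓ₁ ⊔ ℓ₂)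
  x < y = (x ≤ y) × ¬ (x ≈ y)

  sum : (n : ℕ) → (Fin n → Carrier) → Carrier
  sum ℕ.zero     f = 0#
  sum (ℕ.suc n) f = f F.zero + sum n (λ i → f (F.suc i))

  fromℕ : ℕ → Carrier
  fromℕ ℕ.zero     = 0#
  fromℕ (ℕ.suc n) = 1# + fromℕ n

module Submission where

-- Let r i = 1 / p i, and put  A i j = r i · M i j · p j  (the matrix M
-- conjugated by diag p, which is substochastic: every row of A sums to at
-- most 1 because (M p) i ≤ p i).  The entrywise estimate
--
--     M i j ≤ A i j + q · A j i
--
-- holds by comparing p i with p j: if p i ≤ p j then M i j ≤ A i j, and
-- otherwise M i j ≤ q · M j i ≤ q · A j i.  Summing over all i, j and
-- swapping the order of summation in the transposed term gives
--
--     Σ M  ≤  Σ A + q · Σ A  =  (q + 1) · Σ A  ≤  (q + 1) · n.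

open import Defs
open import Level using (Level)
open import Data.Nat using (ℕ; NonZero)
open import Data.Fin using (Fin)
import Data.Nat as ℕ
import Data.Fin as F
open import Data.Product using (proj₁; proj₂)
open import Data.Sum using (inj₁; inj₂)
open import Data.Empty using (⊥-elim)
open import Relation.Binary.Structures using (IsTotalOrder)
open import Relation.Binary.Bundles using (Poset)
import Algebra.Properties.Ring as RingProperties
import Relation.Binary.Reasoning.Setoid as SetoidReasoning
import Relation.Binary.Reasoning.PartialOrder as PosetReasoning

module OrderedFieldProperties {c ℓ₁ ℓ₂ : Level} (F : OrderedField c ℓ₁ ℓ₂) where
  open OrderedField F
  open RingProperties ring using (-‿distribʳ-*; -‿involutive; -1*x≈-x)
  module ≤ = IsTotalOrder isTotalOrder

  poset : Poset c ℓ₁ ℓ₂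
  poset = record { isPartialOrder = ≤.isPartialOrder }

  open PosetReasoning poset

  +-mono₂-≤ : ∀ {a b c d} → a ≤ b → c ≤ d → (a + c) ≤ (b + d)
  +-mono₂-≤ {a} {b} {c} {d} a≤b c≤d = begin
    a + c  ≤⟨ +-mono-≤ c a≤b ⟩
    b + c  ≈⟨ +-comm b c ⟩
    c + b  ≤⟨ +-mono-≤ b c≤d ⟩
    d + b  ≈⟨ +-comm d b ⟩
    b + d  ∎

  ≤-+-nonnegʳ : ∀ {a b} → 0# ≤ b → a ≤ (a + b)
  ≤-+-nonnegʳ {a} {b} 0≤b = begin
    a       ≈⟨ sym (+-identityʳ a) ⟩
    a + 0#  ≤⟨ +-mono₂-≤ ≤.refl 0≤b ⟩
    a + b   ∎

  ≤-+-nonnegˡ : ∀ {a b} → 0# ≤ a → b ≤ (a + b)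
  ≤-+-nonnegˡ {a} {b} 0≤a = begin
    b       ≈⟨ sym (+-identityˡ b) ⟩
    0# + b  ≤⟨ +-mono-≤ b 0≤a ⟩
    a + b   ∎

  +-nonneg : ∀ {a b} → 0# ≤ a → 0# ≤ b → 0# ≤ (a + b)
  +-nonneg 0≤a 0≤b = ≤.trans 0≤a (≤-+-nonnegʳ 0≤b)

  x≤y⇒0≤y-x : ∀ {x y} → x ≤ y → 0# ≤ (y - x)
  x≤y⇒0≤y-x {x} {y} x≤y = begin
    0#     ≈⟨ sym (-‿inverseʳ x) ⟩
    x - x  ≤⟨ +-mono-≤ (- x) x≤y ⟩
    y - x  ∎

  0≤y-x⇒x≤y : ∀ {x y} → 0# ≤ (y - x) → x ≤ y
  0≤y-x⇒x≤y {x} {y} 0≤y-x = begin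
    x              ≈⟨ sym (+-identityˡ x) ⟩
    0# + x         ≤⟨ +-mono-≤ x 0≤y-x ⟩
    (y - x) + x    ≈⟨ +-assoc y (- x) x ⟩
    y + (- x + x)  ≈⟨ +-cong refl (-‿inverseˡ x) ⟩
    y + 0#         ≈⟨ +-identityʳ y ⟩
    y              ∎

  x≤0⇒0≤-x : ∀ {x} → x ≤ 0# → 0# ≤ (- x)
  x≤0⇒0≤-x {x} x≤0 = begin
    0#      ≤⟨ x≤y⇒0≤y-x x≤0 ⟩
    0# - x  ≈⟨ +-identityˡ (- x) ⟩
    - x     ∎

  *-monoˡ-≤-nonneg : ∀ {z x y} → 0# ≤ z → x ≤ y → (z * x) ≤ (z * y)
  *-monoˡ-≤-nonneg {z} {x} {y} 0≤z x≤y = 0≤y-x⇒x≤y (begin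
    0#               ≤⟨ *-nonneg 0≤z (x≤y⇒0≤y-x x≤y) ⟩
    z * (y - x)      ≈⟨ distribˡ z y (- x) ⟩
    z * y + z * - x  ≈⟨ +-cong refl (sym (-‿distribʳ-* z x)) ⟩
    z * y - z * x    ∎)

  -- 1 is nonnegative: otherwise 0 ≤ -1, hence 0 ≤ (-1)·(-1) = 1.
  0≤1 : 0# ≤ 1#
  0≤1 with ≤.total 0# 1#
  ... | inj₁ 0≤1 = 0≤1
  ... | inj₂ 1≤0 = begin
    0#           ≤⟨ *-nonneg 0≤-1 0≤-1 ⟩
    - 1# * - 1#  ≈⟨ -1*x≈-x (- 1#) ⟩
    - - 1#       ≈⟨ -‿involutive 1# ⟩
    1#           ∎
    where
    0≤-1 : 0# ≤ (- 1#)
    0≤-1 = x≤0⇒0≤-x 1≤0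

  recip : ∀ x → 0# < x → Carrier
  recip x 0<x = proj₁ (inverse x (λ x≈0 → proj₂ 0<x (sym x≈0)))

  recip-inverse : ∀ {x} (0<x : 0# < x) → (x * recip x 0<x) ≈ 1#
  recip-inverse {x} 0<x = proj₂ (inverse x (λ x≈0 → proj₂ 0<x (sym x≈0)))

  -- The reciprocal of a positive element is nonnegative: if r = 1/x ≤ 0,
  -- then 0 ≤ x · (-r) = -1, so 1 ≤ 0 ≤ 1, contradicting 0 ≠ 1.
  recip-nonneg : ∀ {x} (0<x : 0# < x) → 0# ≤ recip x 0<x
  recip-nonneg {x} 0<x with ≤.total 0# (recip x 0<x)
  ... | inj₁ 0≤r = 0≤r
  ... | inj₂ r≤0 = ⊥-elim (0≉1 (≤.antisym 0≤1 1≤0))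
    where
    r = recip x 0<x
    1≤0 : 1# ≤ 0#
    1≤0 = 0≤y-x⇒x≤y (begin
      0#          ≤⟨ *-nonneg (proj₁ 0<x) (x≤0⇒0≤-x r≤0) ⟩
      x * - r     ≈⟨ sym (-‿distribʳ-* x r) ⟩
      - (x * r)   ≈⟨ -‿cong (recip-inverse 0<x) ⟩
      - 1#        ≈⟨ sym (+-identityˡ (- 1#)) ⟩
      0# - 1#     ∎)

  recip-cancel : ∀ {y} (0<y : 0# < y) a → a ≈ ((recip y 0<y * a) * y)
  recip-cancel {y} 0<y a = S.begin
    a                   S.≈⟨ sym (*-identityʳ a) ⟩
    a * 1#              S.≈⟨ *-cong refl (sym (recip-inverse 0<y)) ⟩
    a * (y * r)         S.≈⟨ *-cong refl (*-comm y r) ⟩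
    a * (r * y)         S.≈⟨ sym (*-assoc a r y) ⟩
    (a * r) * y         S.≈⟨ *-cong (*-comm a r) refl ⟩
    (r * a) * y         S.∎
    where
    r = recip y 0<y
    module S = SetoidReasoning setoid

module FiniteSums {c ℓ₁ ℓ₂ : Level} (F : OrderedField c ℓ₁ ℓ₂) where
  open OrderedField F
  open OrderedFieldProperties F using (+-mono₂-≤; module ≤)

  sum-cong : ∀ n {f g : Fin n → Carrier} → (∀ i → f i ≈ g i) → sum n f ≈ sum n g
  sum-cong ℕ.zero    f≈g = refl
  sum-cong (ℕ.suc n) f≈g = +-cong (f≈g F.zero) (sum-cong n (λ i → f≈g (F.suc i)))

  sum-mono : ∀ n {f g : Fin n → Carrier} → (∀ i → f i ≤ g i) → sum n f ≤ sum n g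
  sum-mono ℕ.zero    f≤g = ≤.refl
  sum-mono (ℕ.suc n) f≤g = +-mono₂-≤ (f≤g F.zero) (sum-mono n (λ i → f≤g (F.suc i)))

  +-interchange : ∀ a b c d → ((a + b) + (c + d)) ≈ ((a + c) + (b + d))
  +-interchange a b c d = begin
    (a + b) + (c + d)  ≈⟨ +-assoc a b (c + d) ⟩
    a + (b + (c + d))  ≈⟨ +-cong refl (sym (+-assoc b c d)) ⟩
    a + ((b + c) + d)  ≈⟨ +-cong refl (+-cong (+-comm b c) refl) ⟩
    a + ((c + b) + d)  ≈⟨ +-cong refl (+-assoc c b d) ⟩
    a + (c + (b + d))  ≈⟨ sym (+-assoc a c (b + d)) ⟩
    (a + c) + (b + d)  ∎
    where open SetoidReasoning setoid

  sum-+ : ∀ n (f g : Fin n → Carrier) → sum n (λ i → f i + g i) ≈ (sum n f + sum n g)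
  sum-+ ℕ.zero    f g = sym (+-identityʳ 0#)
  sum-+ (ℕ.suc n) f g = trans (+-cong refl (sum-+ n _ _)) (+-interchange _ _ _ _)

  sum-* : ∀ n (k : Carrier) (f : Fin n → Carrier) → sum n (λ i → k * f i) ≈ (k * sum n f)
  sum-* ℕ.zero    k f = sym (zeroʳ k)
  sum-* (ℕ.suc n) k f = trans (+-cong refl (sum-* n k _)) (sym (distribˡ k _ _))

  sum-0 : ∀ n → sum n (λ _ → 0#) ≈ 0#
  sum-0 ℕ.zero    = refl
  sum-0 (ℕ.suc n) = trans (+-identityˡ _) (sum-0 n)

  sum-swap : ∀ n m (f : Fin n → Fin m → Carrier) →
             sum n (λ i → sum m (λ j → f i j)) ≈ sum m (λ j → sum n (λ i → f i j))
  sum-swap ℕ.zero    m f = sym (sum-0 m)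
  sum-swap (ℕ.suc n) m f =
    trans (+-cong refl (sum-swap n m (λ i → f (F.suc i))))
          (sym (sum-+ m (f F.zero) (λ j → sum n (λ i → f (F.suc i) j))))

  sum-1 : ∀ n → sum n (λ _ → 1#) ≈ fromℕ n
  sum-1 ℕ.zero    = refl
  sum-1 (ℕ.suc n) = +-cong refl (sum-1 n)

  sum-symmetrise : ∀ n (q : Carrier) (A : Fin n → Fin n → Carrier) →
    sum n (λ i → sum n (λ j → A i j + q * A j i)) ≈ ((q + 1#) * sum n (λ i → sum n (A i)))
  sum-symmetrise n q A = begin
    sum n (λ i → sum n (λ j → A i j + q * A j i))
      ≈⟨ sum-cong n (λ i → sum-+ n (A i) (λ j → q * A j i)) ⟩
    sum n (λ i → sum n (A i) + sum n (λ j → q * A j i))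
      ≈⟨ sum-+ n (λ i → sum n (A i)) (λ i → sum n (λ j → q * A j i)) ⟩
    ΣA + sum n (λ i → sum n (λ j → q * A j i))
      ≈⟨ +-cong refl (sum-cong n (λ i → sum-* n q (λ j → A j i))) ⟩
    ΣA + sum n (λ i → q * sum n (λ j → A j i))
      ≈⟨ +-cong refl (sum-* n q (λ i → sum n (λ j → A j i))) ⟩
    ΣA + q * sum n (λ i → sum n (λ j → A j i))
      ≈⟨ +-cong refl (*-cong refl (sym (sum-swap n n A))) ⟩
    ΣA + q * ΣA
      ≈⟨ +-cong (sym (*-identityˡ ΣA)) refl ⟩
    1# * ΣA + q * ΣA
      ≈⟨ sym (distribʳ ΣA 1# q) ⟩
    (1# + q) * ΣA
      ≈⟨ *-cong (+-comm 1# q) refl ⟩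
    (q + 1#) * ΣA ∎
    where
    open SetoidReasoning setoid
    ΣA = sum n (λ i → sum n (A i))

  sum-rows-≤1 : ∀ n (A : Fin n → Fin n → Carrier) →
    (∀ i → sum n (A i) ≤ 1#) → sum n (λ i → sum n (A i)) ≤ fromℕ n
  sum-rows-≤1 n A rows≤1 = ≤.trans (sum-mono n rows≤1) (≤.reflexive (sum-1 n))

module ApproximateSymmetry {c ℓ₁ ℓ₂ : Level} (F : OrderedField c ℓ₁ ℓ₂) where
  open OrderedField F
  open OrderedFieldProperties F
  open FiniteSums F using (sum-*)
  open PosetReasoning poset

  -- Entrywise estimate: for positive x, y and nonnegative m, m', q with
  -- m ≤ q · m',   m ≤ (m · y)/x + q · (m' · x)/y.
  -- If x ≤ y the first term alone dominates m, otherwise the second does.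
  entry-bound : ∀ {x y m m′ q} (0<x : 0# < x) (0<y : 0# < y) →
    0# ≤ m → 0# ≤ m′ → 0# ≤ q → m ≤ (q * m′) →
    m ≤ (recip x 0<x * (m * y) + q * (recip y 0<y * (m′ * x)))
  entry-bound {x} {y} {m} {m′} {q} 0<x 0<y 0≤m 0≤m′ 0≤q m≤qm′
    with ≤.total x y
  ... | inj₁ x≤y = begin
    m                  ≈⟨ recip-cancel 0<x m ⟩
    (rx * m) * x       ≤⟨ *-monoˡ-≤-nonneg (*-nonneg (recip-nonneg 0<x) 0≤m) x≤y ⟩
    (rx * m) * y       ≈⟨ *-assoc rx m y ⟩
    rx * (m * y)       ≤⟨ ≤-+-nonnegʳ (*-nonneg 0≤q backward≥0) ⟩
    rx * (m * y) + q * (ry * (m′ * x)) ∎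
    where
    rx = recip x 0<x
    ry = recip y 0<y
    backward≥0 : 0# ≤ (ry * (m′ * x))
    backward≥0 = *-nonneg (recip-nonneg 0<y) (*-nonneg 0≤m′ (proj₁ 0<x))
  ... | inj₂ y≤x = begin
    m                  ≤⟨ m≤qm′ ⟩
    q * m′             ≈⟨ *-cong refl (recip-cancel 0<y m′) ⟩
    q * ((ry * m′) * y) ≤⟨ *-monoˡ-≤-nonneg 0≤q
                            (*-monoˡ-≤-nonneg (*-nonneg (recip-nonneg 0<y) 0≤m′) y≤x) ⟩
    q * ((ry * m′) * x) ≈⟨ *-cong refl (*-assoc ry m′ x) ⟩
    q * (ry * (m′ * x)) ≤⟨ ≤-+-nonnegˡ forward≥0 ⟩
    rx * (m * y) + q * (ry * (m′ * x)) ∎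
    where
    rx = recip x 0<x
    ry = recip y 0<y
    forward≥0 : 0# ≤ (rx * (m * y))
    forward≥0 = *-nonneg (recip-nonneg 0<x) (*-nonneg 0≤m (proj₁ 0<y))

  normalised-row : ∀ n {x} (0<x : 0# < x) (w : Fin n → Carrier) →
    sum n w ≤ x → sum n (λ j → recip x 0<x * w j) ≤ 1#
  normalised-row n {x} 0<x w Σw≤x = begin
    sum n (λ j → rx * w j)  ≈⟨ sum-* n rx w ⟩
    rx * sum n w            ≤⟨ *-monoˡ-≤-nonneg (recip-nonneg 0<x) Σw≤x ⟩
    rx * x                  ≈⟨ *-comm rx x ⟩
    x * rx                  ≈⟨ recip-inverse 0<x ⟩
    1#                      ∎
    where rx = recip x 0<x

lemma1 : ∀ {c ℓ₁ ℓ₂ : Level} (F : OrderedField c ℓ₁ ℓ₂) → let open OrderedField F in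
         (n : ℕ) → .{{_ : NonZero n}} →
         (p : Fin n → Carrier) → (M : Fin n → Fin n → Carrier) → (q : Carrier) →
         (∀ i → 0# < p i) →
         (∀ i j → 0# ≤ M i j) →
         0# ≤ q →
         (∀ i j → M i j ≤ (q * M j i)) →
         (∀ i → sum n (λ j → M i j * p j) ≤ p i) →
         sum n (λ i → sum n (λ j → M i j)) ≤ ((q + 1#) * fromℕ n)
lemma1 F n p M q 0<p 0≤M 0≤q M≤qMᵀ Mp≤p = begin
  sum n (λ i → sum n (λ j → M i j))
    ≤⟨ sum-mono n (λ i → sum-mono n (λ j →
         entry-bound (0<p i) (0<p j) (0≤M i j) (0≤M j i) 0≤q (M≤qMᵀ i j))) ⟩
  sum n (λ i → sum n (λ j → A i j + q * A j i))
    ≈⟨ sum-symmetrise n q A ⟩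
  (q + 1#) * sum n (λ i → sum n (A i))
    ≤⟨ *-monoˡ-≤-nonneg (+-nonneg 0≤q 0≤1) (sum-rows-≤1 n A rows≤1) ⟩
  (q + 1#) * fromℕ n ∎
  where
  open OrderedField F
  open OrderedFieldProperties F
  open FiniteSums F
  open ApproximateSymmetry F
  open PosetReasoning poset

  A : Fin n → Fin n → Carrier
  A i j = recip (p i) (0<p i) * (M i j * p j)

  rows≤1 : ∀ i → sum n (A i) ≤ 1#
  rows≤1 i = normalised-row n (0<p i) (λ j → M i j * p j) (Mp≤p i)
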